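{- Let $G=(V,E)$ be a finite undirected graph with $n=|V|$ vertices and let $\pi\colon V\to\{1,\dots,n\}$ be a bijective vertex order. Then the canonical HCuHL $L^*$ respecting $\pi$ is a hierarchical Customizable Hub Labeling respecting $\pi$, and it is the minimum one: for every hierarchical Customizable Hub Labeling $L$ of $G$ respecting $\pi$ and every $v\in V$ we have $L^*(v)\subseteq L(v)$.
   Context: A labeling of $G$ is a function $L\colon V\to 2^V$. A Customizable Hub Labeling (CuHL) is a labeling satisfying the customizable cover property: for any $s,t\in V$ and any (simple) $s$-$t$-path $P$ in $G$, the set $L(s)\cap L(t)$ contains some vertex of $P$. A labeling $L$ respects a vertex order $\pi$ if $u\in L(v)$ implies $\pi(u)\ge\pi(v)$; a hierarchical CuHL (HCuHL) is a CuHL respecting some vertex order. The canonical HCuHL respecting $\pi$ is the labeling $L^*$ with $u\in L^*(v)$ if and only if there is some $v$-$u$-path in $G$ on which $u$ has maximum rank $\pi$ (in particular $v\in L^*(v)$ via the trivial path). -}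

module Defs where

open import Data.Nat using (ℕ)
open import Data.Fin using (Fin; _≤_)
open import Data.List using (List; []; _∷_)
open import Data.List.Relation.Unary.All using (All)
open import Data.List.Relation.Unary.Unique.Propositional using (Unique)
open import Data.List.Membership.Propositional using (_∈_)
open import Data.Product using (Σ; ∃; _×_; _,_)
open import Relation.Binary.PropositionalEquality using (_≡_)
open import Function.Definitions using (Bijective)

record Graph (n : ℕ) : Set₁ where
  field
    Adj : Fin n → Fin n → Set
    sym : ∀ {u v} → Adj u v → Adj v u
open Graph public

-- A vertex order: a bijection π : V → {1..n} (here {0..n-1} = Fin n).
VertexOrder : ℕ → Set
VertexOrder n = Σ (Fin n → Fin n) (λ π → Bijective _≡_ _≡_ π)

data Walk {n : ℕ} (G : Graph n) : Fin n → Fin n → Set where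
  [_]  : (v : Fin n) → Walk G v v
  _∷⟨_⟩_ : (u : Fin n) {w v : Fin n} → Adj G u w → Walk G w v → Walk G u v

verts : ∀ {n} {G : Graph n} {s t} → Walk G s t → List (Fin n)
verts [ v ] = v ∷ []
verts (u ∷⟨ _ ⟩ p) = u ∷ verts p

IsPath : ∀ {n} {G : Graph n} {s t} → Walk G s t → Set
IsPath p = Unique (verts p)

-- A labeling L : V → 2^V, with subsets as predicates: L v u means u ∈ L(v).
Labeling : ℕ → Set₁
Labeling n = Fin n → Fin n → Set

IsCuHL : ∀ {n} → Graph n → Labeling n → Set
IsCuHL {n} G L = ∀ (s t : Fin n) (P : Walk G s t) → IsPath P →
  ∃ λ x → x ∈ verts P × L s x × L t x

Respects : ∀ {n} → VertexOrder n → Labeling n → Set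
Respects {n} (π , _) L = ∀ (v u : Fin n) → L v u → π v ≤ π u

IsHCuHLRespecting : ∀ {n} → Graph n → VertexOrder n → Labeling n → Set
IsHCuHLRespecting G π L = IsCuHL G L × Respects π L

canonical : ∀ {n} → Graph n → VertexOrder n → Labeling n
canonical G (π , _) v u =
  Σ (Walk G v u) (λ P → IsPath P × All (λ w → π w ≤ π u) (verts P))

-- The maximum-rank vertex m of an s-t path P splits it into an s-m path and
-- (reversed) a t-m path, on both of which m has maximum rank; so m lies in
-- L*(s) ∩ L*(t). Conversely, if u has maximum rank on a v-u path P, any
-- HCuHL L puts some x of P into L(v) ∩ L(u); respecting π gives π u ≤ π x,
-- maximality gives π x ≤ π u, hence x = u by injectivity of π and u ∈ L(v).
module Submission where

open import Defs
open import Data.Nat using (ℕ)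
open import Data.Fin using (Fin; _≤_)
import Data.Fin.Properties as Fin
open import Data.Product using (Σ; ∃; _×_; _,_; proj₁; proj₂)
open import Data.List using (List; []; _∷_; _++_; reverse)
open import Data.List.Properties using (unfold-reverse)
open import Data.List.Relation.Unary.All as All using (All; []; _∷_)
open import Data.List.Relation.Unary.Any using (here; there)
open import Data.List.Relation.Unary.AllPairs using ([]; _∷_)
open import Data.List.Relation.Unary.Unique.Propositional using (Unique)
open import Data.List.Membership.Propositional using (_∈_)
open import Data.List.Relation.Binary.Sublist.Propositional
  using (_⊆_; []; _∷_; _∷ʳ_; ⊆-refl; minimum)
open import Data.List.Relation.Binary.Sublist.Propositional.Properties using (All-resp-⊆)
open import Data.List.Relation.Binary.Permutation.Propositional
  using (_↭_; ↭-sym; ↭-trans; ↭-reflexive; ↭⇒↭ₛ)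
open import Data.List.Relation.Binary.Permutation.Propositional.Properties
  using (↭-reverse; ∈-resp-↭; All-resp-↭)
import Data.List.Relation.Binary.Permutation.Setoid.Properties as Permutationₛ
open import Relation.Binary.PropositionalEquality
  using (_≡_; refl; cong; subst; setoid; module ≡-Reasoning)

Unique-resp-⊆ : ∀ {a} {A : Set a} {xs ys : List A} → xs ⊆ ys → Unique ys → Unique xs
Unique-resp-⊆ []           []       = []
Unique-resp-⊆ (y ∷ʳ xs⊆)   (_ ∷ u)  = Unique-resp-⊆ xs⊆ u
Unique-resp-⊆ (refl ∷ xs⊆) (y∉ ∷ u) = All-resp-⊆ xs⊆ y∉ ∷ Unique-resp-⊆ xs⊆ u

Unique-resp-↭ : ∀ {a} {A : Set a} {xs ys : List A} → xs ↭ ys → Unique xs → Unique ys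
Unique-resp-↭ {A = A} xs↭ys = Permutationₛ.Unique-resp-↭ (setoid A) (↭⇒↭ₛ xs↭ys)

module _ {a n} {A : Set a} (f : A → Fin n) where
  open import Data.List.Extrema (Fin.≤-totalOrder n)

  maximum-∈ : (x : A) (xs : List A) →
              ∃ λ m → m ∈ x ∷ xs × All (λ y → f y ≤ f m) (x ∷ xs)
  maximum-∈ x xs =
    argmax f x xs ,
    argmax-all f (here refl) (All.tabulate there) ,
    f[⊥]≤f[argmax] {f = f} x xs ∷ f[xs]≤f[argmax] {f = f} x xs

module _ {n : ℕ} {G : Graph n} where

  snoc : ∀ {s t w} → Walk G s t → Adj G t w → Walk G s w
  snoc [ v ]          e = v ∷⟨ e ⟩ [ _ ]
  snoc (u ∷⟨ e′ ⟩ p) e = u ∷⟨ e′ ⟩ snoc p e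

  verts-snoc : ∀ {s t w} (p : Walk G s t) (e : Adj G t w) → verts (snoc p e) ≡ verts p ++ w ∷ []
  verts-snoc [ v ]          e = refl
  verts-snoc (u ∷⟨ e′ ⟩ p) e = cong (u ∷_) (verts-snoc p e)

  rev : ∀ {s t} → Walk G s t → Walk G t s
  rev [ v ]         = [ v ]
  rev (u ∷⟨ e ⟩ p) = snoc (rev p) (sym G e)

  verts-rev : ∀ {s t} (p : Walk G s t) → verts (rev p) ≡ reverse (verts p)
  verts-rev [ v ]         = refl
  verts-rev (u ∷⟨ e ⟩ p) = begin
    verts (snoc (rev p) (sym G e)) ≡⟨ verts-snoc (rev p) (sym G e) ⟩
    verts (rev p) ++ u ∷ []        ≡⟨ cong (_++ u ∷ []) (verts-rev p) ⟩
    reverse (verts p) ++ u ∷ []    ≡⟨ unfold-reverse u (verts p) ⟨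
    reverse (u ∷ verts p)          ∎
    where open ≡-Reasoning

  verts-rev-↭ : ∀ {s t} (p : Walk G s t) → verts p ↭ verts (rev p)
  verts-rev-↭ p = ↭-sym (↭-trans (↭-reflexive (verts-rev p)) (↭-reverse (verts p)))

  rev-isPath : ∀ {s t} (p : Walk G s t) → IsPath p → IsPath (rev p)
  rev-isPath p = Unique-resp-↭ (verts-rev-↭ p)

  prefix : ∀ {s t x} (p : Walk G s t) → x ∈ verts p → Σ (Walk G s x) λ q → verts q ⊆ verts p
  prefix [ v ]         (here refl) = [ v ] , ⊆-refl
  prefix (u ∷⟨ e ⟩ p) (here refl) = [ u ] , refl ∷ minimum (verts p)
  prefix (u ∷⟨ e ⟩ p) (there x∈p) with prefix p x∈p
  ... | q , q⊆p = u ∷⟨ e ⟩ q , refl ∷ q⊆p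

  All-head : ∀ {ℓ} {P : Fin n → Set ℓ} {s t} (p : Walk G s t) → All P (verts p) → P s
  All-head [ v ]         (Ps ∷ _) = Ps
  All-head (u ∷⟨ e ⟩ p) (Ps ∷ _) = Ps

  walk-maximum : (f : Fin n → Fin n) {s t : Fin n} (p : Walk G s t) →
                 ∃ λ m → m ∈ verts p × All (λ w → f w ≤ f m) (verts p)
  walk-maximum f [ v ]         = maximum-∈ f v []
  walk-maximum f (u ∷⟨ e ⟩ p) = maximum-∈ f u (verts p)

module _ {n : ℕ} (G : Graph n) (π : VertexOrder n) where
  private
    rank = proj₁ π
    IsTopOf : ∀ {s t} → Fin n → Walk G s t → Set
    IsTopOf x p = All (λ w → rank w ≤ rank x) (verts p)

  canonical-∋-top : ∀ {s t x} (p : Walk G s t) → IsPath p → x ∈ verts p → IsTopOf x p →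
                    canonical G π s x
  canonical-∋-top p p-path x∈p x-top with prefix p x∈p
  ... | q , q⊆p = q , Unique-resp-⊆ q⊆p p-path , All-resp-⊆ q⊆p x-top

  canonical-isCuHL : IsCuHL G (canonical G π)
  canonical-isCuHL s t p p-path with walk-maximum rank p
  ... | m , m∈p , m-top =
    m , m∈p ,
    canonical-∋-top p p-path m∈p m-top ,
    canonical-∋-top (rev p) (rev-isPath p p-path)
      (∈-resp-↭ (verts-rev-↭ p) m∈p) (All-resp-↭ (verts-rev-↭ p) m-top)

  canonical-respects : Respects π (canonical G π)
  canonical-respects v u (p , _ , u-top) = All-head p u-top

  canonical-minimal : ∀ (L : Labeling n) → IsHCuHLRespecting G π L →
                      ∀ (v u : Fin n) → canonical G π v u → L v u
  canonical-minimal L (L-cover , L-respects) v u (p , p-path , u-top)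
    with L-cover v u p p-path
  ... | x , x∈p , x∈Lv , x∈Lu = subst (L v) x≡u x∈Lv
    where
    x≡u : x ≡ u
    x≡u = proj₁ (proj₂ π) (Fin.≤-antisym (All.lookup u-top x∈p) (L-respects u x x∈Lu))

mainTheorem1 : (n : ℕ) (G : Graph n) (π : VertexOrder n) →
    IsHCuHLRespecting G π (canonical G π)
    × (∀ (L : Labeling n) → IsHCuHLRespecting G π L →
        ∀ (v u : Fin n) → canonical G π v u → L v u)
mainTheorem1 n G π = (canonical-isCuHL G π , canonical-respects G π) , canonical-minimal G π
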